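{- Let $D$ be a digraph. The following are equivalent: (i) $\langle D\rangle$ has at most one idempotent in every $\mathscr{L}$-class and every $\mathscr{R}$-class; (ii) $\langle D\rangle$ is $\mathscr{J}$-trivial; (iii) $D$ is acyclic and every vertex of $D$ has out-degree at most $1$.
   Context: For $a\neq b$ in $\{1,\ldots,n\}$, $(a\to b)$ denotes the transformation mapping $a$ to $b$ and fixing every other point; transformations are composed left to right. For a digraph $D$ on $\{1,\ldots,n\}$ (no loops, no multiple arcs), $\langle D\rangle$ is the semigroup generated by all $(a\to b)$ with $(a,b)$ an arc. Acyclic means having no directed cycle. $\mathscr{L},\mathscr{R},\mathscr{J}$ are Green's relations; a semigroup is $\mathscr{J}$-trivial if $\mathscr{J}$-related elements are equal. -}

module Defs where

open import Data.Nat using (ℕ; _≤_)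
open import Data.Bool using (Bool; true; false; T; if_then_else_)
open import Data.Fin using (Fin; _≟_)
open import Data.List using (List; length; filter)
open import Data.Fin.Base using ()
open import Data.List.Base using ()
open import Data.Fin using () renaming (zero to fz)
open import Data.Product using (Σ; _×_; ∃; ∃-syntax; _,_)
open import Data.Sum using (_⊎_)
open import Data.Empty using (⊥)
open import Relation.Nullary using (¬_; does)
open import Relation.Binary.PropositionalEquality using (_≡_)
open import Data.Bool.Properties using (T?)
import Data.Fin as F
import Data.List as L

Transformation : ℕ → Set
Transformation n = Fin n → Fin n

_≈_ : ∀ {n} → Transformation n → Transformation n → Set
f ≈ g = ∀ x → f x ≡ g x

-- Composition left to right: (f ⨾ g) first applies f, then g.
_⨾_ : ∀ {n} → Transformation n → Transformation n → Transformation n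
(f ⨾ g) x = g (f x)

arrow : ∀ {n} → Fin n → Fin n → Transformation n
arrow a b x = if does (x ≟ a) then b else x

record Digraph (n : ℕ) : Set where
  field
    adj    : Fin n → Fin n → Bool
    noLoop : ∀ a → ¬ T (adj a a)
open Digraph public

record Arc {n : ℕ} (D : Digraph n) : Set where
  constructor arc
  field
    src : Fin n
    tgt : Fin n
    isArc : T (adj D src tgt)

outDegree : ∀ {n} → Digraph n → Fin n → ℕ
outDegree {n} D a = length (filter (λ b → T? (adj D a b)) (L.allFin n))

data Walk {n : ℕ} (D : Digraph n) : Fin n → Fin n → Set where
  step : ∀ {a b} → T (adj D a b) → Walk D a b
  _∷_  : ∀ {a b c} → T (adj D a b) → Walk D b c → Walk D a c

Acyclic : ∀ {n} → Digraph n → Set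
Acyclic {n} D = ∀ (a : Fin n) → ¬ Walk D a a

-- Elements of the semigroup ⟨D⟩ are presented by nonempty words in the generators.
data Word {n : ℕ} (D : Digraph n) : Set where
  [_] : Arc D → Word D
  _∷_ : Arc D → Word D → Word D

gen : ∀ {n} {D : Digraph n} → Arc D → Transformation n
gen (arc a b _) = arrow a b

eval : ∀ {n} {D : Digraph n} → Word D → Transformation n
eval [ e ]    = gen e
eval (e ∷ w)  = gen e ⨾ eval w

module _ {n : ℕ} (D : Digraph n) where

  -- Elements of ⟨D⟩ are  eval w  for words w.
  -- Green's preorders in ⟨D⟩ (via ⟨D⟩¹):
  -- f ≤L g  iff  f ∈ ⟨D⟩¹ g ;  f ≤R g iff f ∈ g ⟨D⟩¹ ;  f ≤J g iff f ∈ ⟨D⟩¹ g ⟨D⟩¹.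
  ≤L : Transformation n → Transformation n → Set
  ≤L f g = (f ≈ g) ⊎ (∃[ s ] (f ≈ (eval {D = D} s ⨾ g)))

  ≤R : Transformation n → Transformation n → Set
  ≤R f g = (f ≈ g) ⊎ (∃[ t ] (f ≈ (g ⨾ eval {D = D} t)))

  ≤J : Transformation n → Transformation n → Set
  ≤J f g = (f ≈ g)
         ⊎ (∃[ s ] (f ≈ (eval {D = D} s ⨾ g)))
         ⊎ (∃[ t ] (f ≈ (g ⨾ eval {D = D} t)))
         ⊎ (∃[ s ] ∃[ t ] (f ≈ ((eval {D = D} s ⨾ g) ⨾ eval {D = D} t)))

  GreenL GreenR GreenJ : Word D → Word D → Set
  GreenL u v = ≤L (eval u) (eval v) × ≤L (eval v) (eval u)
  GreenR u v = ≤R (eval u) (eval v) × ≤R (eval v) (eval u)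
  GreenJ u v = ≤J (eval u) (eval v) × ≤J (eval v) (eval u)

  Idempotent : Word D → Set
  Idempotent u = (eval u ⨾ eval u) ≈ eval u

  AtMostOneIdempotentPerLR : Set
  AtMostOneIdempotentPerLR =
    (∀ (e f : Word D) → Idempotent e → Idempotent f → GreenL e f → eval e ≈ eval f)
    × (∀ (e f : Word D) → Idempotent e → Idempotent f → GreenR e f → eval e ≈ eval f)

  JTrivial : Set
  JTrivial = ∀ (u v : Word D) → GreenJ u v → eval u ≈ eval v

  AcyclicOutDegLeOne : Set
  AcyclicOutDegLeOne = Acyclic D × (∀ a → outDegree D a ≤ 1)

module Submission where

-- (ii) ⇒ (i) because L ⊆ J and R ⊆ J.
-- (i) ⇒ (iii): a cycle through an arc a → b gives the R-related idempotents E and E(a → b),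
-- where E collapses the vertices of the cycle onto a; they differ at a. Two arcs a → b and
-- a → c give the L-related idempotents (a → b) and (a → c).
-- (iii) ⇒ (ii): let x ≤ y mean that y is reachable from x. For acyclic D this is a partial
-- order, and when all out-degrees are at most 1 every element of ⟨D⟩ is extensive and
-- monotone for it. Hence s ≤J t forces t x ≤ s x for all x, so J-related elements are equal.

open import Defs
open import Data.Bool using (T; if_then_else_)
open import Data.Bool.Properties using (T?)
open import Data.Empty using (⊥-elim)
open import Data.Fin using (Fin; _≟_)
open import Data.List using (List; []; _∷_; length; filter; allFin)
open import Data.List.Membership.Propositional using (_∈_; _∉_)
open import Data.List.Membership.Propositional.Properties using (∈-allFin; ∈-filter⁺; ∈-filter⁻)
import Data.List.Membership.DecPropositional as DecMembership
open import Data.List.Relation.Binary.Subset.Propositional using (_⊆_)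
open import Data.List.Relation.Unary.All using (_∷_)
open import Data.List.Relation.Unary.AllPairs using (_∷_)
open import Data.List.Relation.Unary.Any using (here; there)
open import Data.List.Relation.Unary.Unique.Propositional using (Unique)
open import Data.List.Relation.Unary.Unique.Propositional.Properties using (allFin⁺; filter⁺)
open import Data.Nat using (ℕ; _≤_; z≤n; s≤s)
open import Data.Product using (_×_; _,_; proj₂)
open import Data.Sum using (_⊎_; inj₁; inj₂)
open import Function using (_⇔_; mk⇔; Equivalence)
open import Relation.Nullary using (does; yes; no)
open import Relation.Nullary.Decidable using (dec-true; dec-false)
open import Relation.Unary using (Decidable)
open import Relation.Binary.PropositionalEquality
  using (_≡_; _≢_; refl; sym; trans; cong; module ≡-Reasoning)

module _ {A : Set} where

  length≤1⇒∈-unique : ∀ {xs : List A} {x y} → length xs ≤ 1 → x ∈ xs → y ∈ xs → x ≡ y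
  length≤1⇒∈-unique {_ ∷ []}    _         (here refl) (here refl) = refl
  length≤1⇒∈-unique {_ ∷ _ ∷ _} (s≤s ()) _           _

  ∈-unique⇒length≤1 : ∀ {xs : List A} → Unique xs →
                      (∀ {x y} → x ∈ xs → y ∈ xs → x ≡ y) → length xs ≤ 1
  ∈-unique⇒length≤1 {[]}        _                  _  = z≤n
  ∈-unique⇒length≤1 {_ ∷ []}    _                  _  = s≤s z≤n
  ∈-unique⇒length≤1 {_ ∷ _ ∷ _} ((x≢y ∷ _) ∷ _) eq =
    ⊥-elim (x≢y (eq (here refl) (there (here refl))))

module _ {n : ℕ} where

  open DecMembership (_≟_ {n}) using (_∈?_)

  idempotent-resp-≈ : {f g : Transformation n} → f ≈ g → (g ⨾ g) ≈ g → (f ⨾ f) ≈ f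
  idempotent-resp-≈ {f} {g} f≈g gg≈g x = begin
    f (f x) ≡⟨ cong f (f≈g x) ⟩
    f (g x) ≡⟨ f≈g (g x) ⟩
    g (g x) ≡⟨ gg≈g x ⟩
    g x     ≡⟨ sym (f≈g x) ⟩
    f x     ∎
    where open ≡-Reasoning

  arrow-source : (a b : Fin n) → arrow a b a ≡ b
  arrow-source a b rewrite dec-true (a ≟ a) refl = refl

  arrow-fixes : ∀ {a x} (b : Fin n) → x ≢ a → arrow a b x ≡ x
  arrow-fixes {a} {x} b x≢a rewrite dec-false (x ≟ a) x≢a = refl

  -- Splitting on x ≟ a also splits the test inside arrow a b x, which then computes.
  arrow-absorbs : ∀ {a b} (c : Fin n) → b ≢ a → (arrow a b ⨾ arrow a c) ≈ arrow a b
  arrow-absorbs {a} {b} c b≢a x with x ≟ a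
  ... | yes refl = arrow-fixes c b≢a
  ... | no x≢a   = arrow-fixes c x≢a

  -- Opaque, so that a split on x ∈? S leaves it alone; it is used only via collapse-∈ and collapse-∉.
  opaque
    collapse : List (Fin n) → Fin n → Transformation n
    collapse S c x = if does (x ∈? S) then c else x

    collapse-∈ : ∀ {S x} (c : Fin n) → x ∈ S → collapse S c x ≡ c
    collapse-∈ {S} {x} c x∈S rewrite dec-true (x ∈? S) x∈S = refl

    collapse-∉ : ∀ {S x} (c : Fin n) → x ∉ S → collapse S c x ≡ x
    collapse-∉ {S} {x} c x∉S rewrite dec-false (x ∈? S) x∉S = refl

  collapse-idempotent : ∀ {S c} → c ∈ S → (collapse S c ⨾ collapse S c) ≈ collapse S c
  collapse-idempotent {S} {c} c∈S x with x ∈? S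
  ... | yes x∈S rewrite collapse-∈ c x∈S = collapse-∈ c c∈S
  ... | no x∉S  rewrite collapse-∉ c x∉S = collapse-∉ c x∉S

  arrow≈collapse : (a b : Fin n) → arrow a b ≈ collapse (a ∷ []) b
  arrow≈collapse a b x with x ≟ a
  ... | yes refl = sym (collapse-∈ b (here refl))
  ... | no x≢a   = sym (collapse-∉ b λ { (here x≡a) → x≢a x≡a })

  collapse-∷ : ∀ {a S x} (b : Fin n) → x ≢ a → collapse (a ∷ S) b x ≡ collapse S b x
  collapse-∷ {a} {S} {x} b x≢a with x ∈? S
  ... | yes x∈S = trans (collapse-∈ b (there x∈S)) (sym (collapse-∈ b x∈S))
  ... | no x∉S  = trans (collapse-∉ b λ { (here x≡a) → x≢a x≡a ; (there x∈S) → x∉S x∈S })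
                        (sym (collapse-∉ b x∉S))

  arrow⨾collapse : ∀ {a b c S} → c ∈ S → (arrow a c ⨾ collapse S b) ≈ collapse (a ∷ S) b
  arrow⨾collapse {a} {b} c∈S x with x ≟ a
  ... | yes refl = trans (collapse-∈ b c∈S) (sym (collapse-∈ b (here refl)))
  ... | no x≢a   = sym (collapse-∷ b x≢a)

  collapse⨾arrow : ∀ {a b S} → a ∈ S → (collapse S a ⨾ arrow a b) ≈ collapse S b
  collapse⨾arrow {a} {b} {S} a∈S x with x ∈? S
  ... | yes x∈S rewrite collapse-∈ a x∈S | collapse-∈ b x∈S = arrow-source a b
  ... | no x∉S  rewrite collapse-∉ a x∉S | collapse-∉ b x∉S = arrow-fixes b λ { refl → x∉S a∈S }

  collapse⨾collapse : ∀ {b c S T} → b ∈ T → T ⊆ S → (collapse S b ⨾ collapse T c) ≈ collapse S c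
  collapse⨾collapse {b} {c} {S} {T} b∈T T⊆S x with x ∈? S
  ... | yes x∈S rewrite collapse-∈ b x∈S | collapse-∈ c x∈S = collapse-∈ c b∈T
  ... | no x∉S  rewrite collapse-∉ b x∉S | collapse-∉ c x∉S = collapse-∉ c (λ x∈T → x∉S (T⊆S x∈T))

Deterministic : ∀ {n} → Digraph n → Set
Deterministic D = ∀ {a b c} → T (adj D a b) → T (adj D a c) → b ≡ c

Reachable : ∀ {n} → Digraph n → Fin n → Fin n → Set
Reachable D x y = x ≡ y ⊎ Walk D x y

module _ {n : ℕ} {D : Digraph n} where

  arc⇒≢ : ∀ {a b} → T (adj D a b) → b ≢ a
  arc⇒≢ {a} p refl = noLoop D a p

  outDegree≤1⇔deterministic : (∀ a → outDegree D a ≤ 1) ⇔ Deterministic D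
  outDegree≤1⇔deterministic = mk⇔ deterministic deg≤1
    where
    arcFrom? : ∀ a → Decidable (λ b → T (adj D a b))
    arcFrom? a b = T? (adj D a b)

    deterministic : (∀ a → outDegree D a ≤ 1) → Deterministic D
    deterministic deg {a} {b} {c} p q =
      length≤1⇒∈-unique (deg a) (∈-filter⁺ (arcFrom? a) (∈-allFin b) p)
                                (∈-filter⁺ (arcFrom? a) (∈-allFin c) q)

    deg≤1 : Deterministic D → ∀ a → outDegree D a ≤ 1
    deg≤1 det a = ∈-unique⇒length≤1 (filter⁺ (arcFrom? a) (allFin⁺ n))
      λ b∈ c∈ → det (isArc b∈) (isArc c∈)
      where
      isArc : ∀ {b} → b ∈ filter (arcFrom? a) (allFin n) → T (adj D a b)
      isArc b∈ = proj₂ (∈-filter⁻ (arcFrom? a) {xs = allFin n} b∈)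

  _++ʷ_ : Word D → Word D → Word D
  [ e ]   ++ʷ v = e ∷ v
  (e ∷ u) ++ʷ v = e ∷ (u ++ʷ v)

  eval-++ʷ : ∀ u v → eval (u ++ʷ v) ≈ (eval u ⨾ eval v)
  eval-++ʷ [ e ]   v x = refl
  eval-++ʷ (e ∷ u) v x = eval-++ʷ u v (gen e x)

  walkWord : ∀ {a b} → Walk D a b → Word D
  walkWord (step {a} {b} p)  = [ arc a b p ]
  walkWord (_∷_ {a} {b} p w) = arc a b p ∷ walkWord w

  sources : ∀ {a b} → Walk D a b → List (Fin n)
  sources (step {a} _)  = a ∷ []
  sources (_∷_ {a} _ w) = a ∷ sources w

  source∈sources : ∀ {a b} (w : Walk D a b) → a ∈ sources w
  source∈sources (step _) = here refl
  source∈sources (_ ∷ _)  = here refl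

  walkWord≈collapse : ∀ {a b} (w : Walk D a b) → eval (walkWord w) ≈ collapse (sources w) b
  walkWord≈collapse (step {a} {b} _) = arrow≈collapse a b
  walkWord≈collapse (_∷_ {a} {c} _ w) x =
    trans (walkWord≈collapse w (arrow a c x)) (arrow⨾collapse (source∈sources w) x)

  IdempotentsSeparatedBy : (Word D → Word D → Set) → Set
  IdempotentsSeparatedBy G =
    ∀ e f → Idempotent D e → Idempotent D f → G e f → eval e ≈ eval f

  idempotentsSeparatedByR⇒acyclic : IdempotentsSeparatedBy (GreenR D) → Acyclic D
  idempotentsSeparatedByR⇒acyclic _ a (step p) = noLoop D a p
  idempotentsSeparatedByR⇒acyclic separated a cycle@(_∷_ {b = b} p w) = arc⇒≢ p (begin
    b              ≡⟨ sym (collapse-∈ b (here refl)) ⟩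
    collapse S b a ≡⟨ sym (F≈ a) ⟩
    eval F a       ≡⟨ sym (separated E F E-idempotent F-idempotent E-R-F a) ⟩
    eval E a       ≡⟨ E≈ a ⟩
    collapse S a a ≡⟨ collapse-∈ a (here refl) ⟩
    a              ∎)
    where
    open ≡-Reasoning
    S = sources cycle
    E = walkWord cycle
    F = E ++ʷ [ arc a b p ]

    E≈ : eval E ≈ collapse S a
    E≈ = walkWord≈collapse cycle

    F≈ : eval F ≈ collapse S b
    F≈ x = trans (eval-++ʷ E _ x) (trans (cong (arrow a b) (E≈ x)) (collapse⨾arrow (here refl) x))

    E-idempotent : Idempotent D E
    E-idempotent = idempotent-resp-≈ E≈ (collapse-idempotent (here refl))

    F-idempotent : Idempotent D F
    F-idempotent = idempotent-resp-≈ F≈ (collapse-idempotent (there (source∈sources w)))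

    E≈F⨾w : eval E ≈ (eval F ⨾ eval (walkWord w))
    E≈F⨾w x = begin
      eval E x                                ≡⟨ E≈ x ⟩
      collapse S a x                          ≡⟨ sym (collapse⨾collapse (source∈sources w) there x) ⟩
      collapse (sources w) a (collapse S b x) ≡⟨ sym (walkWord≈collapse w _) ⟩
      eval (walkWord w) (collapse S b x)      ≡⟨ cong (eval (walkWord w)) (sym (F≈ x)) ⟩
      eval (walkWord w) (eval F x)            ∎

    E-R-F : GreenR D E F
    E-R-F = inj₂ (walkWord w , E≈F⨾w) , inj₂ ([ arc a b p ] , eval-++ʷ E _)

  idempotentsSeparatedByL⇒deterministic : IdempotentsSeparatedBy (GreenL D) → Deterministic D
  idempotentsSeparatedByL⇒deterministic separated {a} {b} {c} p q = begin
    b           ≡⟨ sym (arrow-source a b) ⟩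
    arrow a b a ≡⟨ separated e f e-idempotent f-idempotent e-L-f a ⟩
    arrow a c a ≡⟨ arrow-source a c ⟩
    c           ∎
    where
    open ≡-Reasoning
    e f : Word D
    e = [ arc a b p ]
    f = [ arc a c q ]

    e-idempotent : Idempotent D e
    e-idempotent = arrow-absorbs b (arc⇒≢ p)

    f-idempotent : Idempotent D f
    f-idempotent = arrow-absorbs c (arc⇒≢ q)

    e-L-f : GreenL D e f
    e-L-f = inj₂ (e , λ x → sym (arrow-absorbs c (arc⇒≢ p) x))
          , inj₂ (f , λ x → sym (arrow-absorbs b (arc⇒≢ q) x))

  ≤L⇒≤J : ∀ {f g} → ≤L D f g → ≤J D f g
  ≤L⇒≤J (inj₁ f≈g)  = inj₁ f≈g
  ≤L⇒≤J (inj₂ f≈sg) = inj₂ (inj₁ f≈sg)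

  ≤R⇒≤J : ∀ {f g} → ≤R D f g → ≤J D f g
  ≤R⇒≤J (inj₁ f≈g)  = inj₁ f≈g
  ≤R⇒≤J (inj₂ f≈gt) = inj₂ (inj₂ (inj₁ f≈gt))

  JTrivial⇒idempotentsSeparatedByLR : JTrivial D → AtMostOneIdempotentPerLR D
  JTrivial⇒idempotentsSeparatedByLR trivial =
      (λ e f _ _ (e≤f , f≤e) → trivial e f (≤L⇒≤J e≤f , ≤L⇒≤J f≤e))
    , (λ e f _ _ (e≤f , f≤e) → trivial e f (≤R⇒≤J e≤f , ≤R⇒≤J f≤e))

  _◅◅_ : ∀ {x y z} → Walk D x y → Walk D y z → Walk D x z
  step p  ◅◅ w′ = p ∷ w′
  (p ∷ w) ◅◅ w′ = p ∷ (w ◅◅ w′)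

  reachable-trans : ∀ {x y z} → Reachable D x y → Reachable D y z → Reachable D x z
  reachable-trans (inj₁ refl) r           = r
  reachable-trans (inj₂ w)    (inj₁ refl) = inj₂ w
  reachable-trans (inj₂ w)    (inj₂ w′)   = inj₂ (w ◅◅ w′)

  acyclic⇒reachable-antisym : Acyclic D → ∀ {x y} → Reachable D x y → Reachable D y x → x ≡ y
  acyclic⇒reachable-antisym _       (inj₁ x≡y) _          = x≡y
  acyclic⇒reachable-antisym _       (inj₂ _)   (inj₁ y≡x) = sym y≡x
  acyclic⇒reachable-antisym acyclic (inj₂ w)   (inj₂ w′)  = ⊥-elim (acyclic _ (w ◅◅ w′))

  eval-extensive : ∀ (u : Word D) x → Reachable D x (eval u x)
  eval-extensive [ e ]   x = gen-extensive e x
    where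
    gen-extensive : ∀ (e : Arc D) x → Reachable D x (gen e x)
    gen-extensive (arc a b p) x with x ≟ a
    ... | yes refl = inj₂ (step p)
    ... | no _     = inj₁ refl
  eval-extensive (e ∷ u) x = reachable-trans (eval-extensive [ e ] x) (eval-extensive u (gen e x))

  module _ (deterministic : Deterministic D) where

    reachable-past-arc : ∀ {a b y} → T (adj D a b) → y ≢ a → Reachable D a y → Reachable D b y
    reachable-past-arc _ y≢a (inj₁ a≡y)      = ⊥-elim (y≢a (sym a≡y))
    reachable-past-arc p _   (inj₂ (step q)) = inj₁ (deterministic p q)
    reachable-past-arc p _   (inj₂ (q ∷ w)) rewrite deterministic p q = inj₂ w

    gen-monotone : ∀ (e : Arc D) {x y} → Reachable D x y → Reachable D (gen e x) (gen e y)
    gen-monotone (arc a b p) {x} {y} r with x ≟ a | y ≟ a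
    ... | yes refl | yes refl = inj₁ refl
    ... | yes refl | no y≢a   = reachable-past-arc p y≢a r
    ... | no _     | yes refl = reachable-trans r (inj₂ (step p))
    ... | no _     | no _     = r

    eval-monotone : ∀ (u : Word D) {x y} → Reachable D x y → Reachable D (eval u x) (eval u y)
    eval-monotone [ e ]   r = gen-monotone e r
    eval-monotone (e ∷ u) r = eval-monotone u (gen-monotone e r)

    ≤J⇒reachable : ∀ {f} (v : Word D) → ≤J D f (eval v) → ∀ x → Reachable D (eval v x) (f x)
    ≤J⇒reachable v (inj₁ f≈v) x rewrite f≈v x = inj₁ refl
    ≤J⇒reachable v (inj₂ (inj₁ (s , f≈sv))) x rewrite f≈sv x =
      eval-monotone v (eval-extensive s x)
    ≤J⇒reachable v (inj₂ (inj₂ (inj₁ (t , f≈vt)))) x rewrite f≈vt x =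
      eval-extensive t (eval v x)
    ≤J⇒reachable v (inj₂ (inj₂ (inj₂ (s , t , f≈svt)))) x rewrite f≈svt x =
      reachable-trans (eval-monotone v (eval-extensive s x)) (eval-extensive t _)

  acyclic×deterministic⇒JTrivial : Acyclic D → Deterministic D → JTrivial D
  acyclic×deterministic⇒JTrivial acyclic deterministic u v (u≤v , v≤u) x =
    acyclic⇒reachable-antisym acyclic
      (≤J⇒reachable deterministic u v≤u x) (≤J⇒reachable deterministic v u≤v x)

proposition4p5 : ∀ (n : ℕ) (D : Digraph n) →
    (AtMostOneIdempotentPerLR D ⇔ JTrivial D) × (JTrivial D ⇔ AcyclicOutDegLeOne D)
proposition4p5 n D = mk⇔ i⇒ii ii⇒i , mk⇔ (λ ii → i⇒iii (ii⇒i ii)) iii⇒ii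
  where
  open Equivalence (outDegree≤1⇔deterministic {D = D})

  i⇒iii : AtMostOneIdempotentPerLR D → AcyclicOutDegLeOne D
  i⇒iii (separatedL , separatedR) =
      idempotentsSeparatedByR⇒acyclic separatedR
    , from (idempotentsSeparatedByL⇒deterministic separatedL)

  iii⇒ii : AcyclicOutDegLeOne D → JTrivial D
  iii⇒ii (acyclic , deg) = acyclic×deterministic⇒JTrivial acyclic (to deg)

  ii⇒i : JTrivial D → AtMostOneIdempotentPerLR D
  ii⇒i = JTrivial⇒idempotentsSeparatedByLR

  i⇒ii : AtMostOneIdempotentPerLR D → JTrivial D
  i⇒ii i = iii⇒ii (i⇒iii i)
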